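{- Let $(N,+,-)$ be a difference family biquasigroup. Then $(N,+)$ has a right identity, i.e. there is $o\in N$ with $a+o=a$ for all $a\in N$ (and it is unique), and there is a constant $e\in N$ such that $e=a-a$ for all $a\in N$.
   Context: A quasigroup is a set $S$ with a binary operation $\circ$ such that for all $a,b\in S$ each of $a\circ x=b$ and $y\circ a=b$ has a unique solution. A difference family biquasigroup (DFBQ) $(N,+,-)$ is a set $N$ with two binary operations $+$ and $-$ such that $(N,+)$ and $(N,-)$ are both quasigroups and $a-b=(a+c)-(b+c)$ for all $a,b,c\in N$. -}

module Defs where

open import Level using (Level)
open import Data.Product using (Σ; _×_; _,_; ∃!)
open import Relation.Binary.PropositionalEquality using (_≡_)

record IsQuasigroupOp {ℓ : Level} (S : Set ℓ) (_∘_ : S → S → S) : Set ℓ where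
  field
    leftSolve  : ∀ (a b : S) → ∃! _≡_ (λ x → a ∘ x ≡ b)
    rightSolve : ∀ (a b : S) → ∃! _≡_ (λ y → y ∘ a ≡ b)

record IsDFBQ {ℓ : Level} (N : Set ℓ) (_⊕_ : N → N → N) (_⊖_ : N → N → N) : Set ℓ where
  field
    plusQuasigroup  : IsQuasigroupOp N _⊕_
    minusQuasigroup : IsQuasigroupOp N _⊖_
    shiftInvariant  : ∀ (a b c : N) → a ⊖ b ≡ (a ⊕ c) ⊖ (b ⊕ c)

-- Translating by c does not change differences, so if n + o = n then
-- (a + o) - n = (a + o) - (n + o) = a - n, and cancelling n in the quasigroup
-- (N, -) gives a + o = a; the right identity is then forced to be the solution
-- of n + x = n.  Similarly a - a = (n + c) - (n + c) = n - n for the c with n + c = a.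
module Submission where

open import Defs
open import Level using (Level)
open import Data.Product using (Σ; _×_; _,_; ∃!; proj₁; proj₂)
open import Relation.Binary.PropositionalEquality using (_≡_; refl; sym; trans; cong; module ≡-Reasoning)

module _ {ℓ : Level} {S : Set ℓ} {_∘_ : S → S → S} (q : IsQuasigroupOp S _∘_) where
  open IsQuasigroupOp q

  cancelʳ : ∀ {x y c : S} → x ∘ c ≡ y ∘ c → x ≡ y
  cancelʳ {x} {y} {c} x∘c≡y∘c = trans (sym (unique x∘c≡y∘c)) (unique refl)
    where
    unique : ∀ {z} → z ∘ c ≡ y ∘ c → proj₁ (rightSolve c (y ∘ c)) ≡ z
    unique = proj₂ (proj₂ (rightSolve c (y ∘ c)))

  leftQuotient : S → S → S
  leftQuotient a b = proj₁ (leftSolve a b)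

  leftQuotient-spec : ∀ a b → a ∘ leftQuotient a b ≡ b
  leftQuotient-spec a b = proj₁ (proj₂ (leftSolve a b))

  leftQuotient-unique : ∀ {a b x} → a ∘ x ≡ b → leftQuotient a b ≡ x
  leftQuotient-unique {a} {b} = proj₂ (proj₂ (leftSolve a b))

module _ {ℓ : Level} {N : Set ℓ} {_⊕_ _⊖_ : N → N → N} (dfbq : IsDFBQ N _⊕_ _⊖_) where
  open IsDFBQ dfbq
  open ≡-Reasoning

  fixedPoint⇒rightIdentity : ∀ {n o} → n ⊕ o ≡ n → ∀ a → a ⊕ o ≡ a
  fixedPoint⇒rightIdentity {n} {o} n⊕o≡n a = cancelʳ minusQuasigroup (begin
    (a ⊕ o) ⊖ n        ≡⟨ cong ((a ⊕ o) ⊖_) n⊕o≡n ⟨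
    (a ⊕ o) ⊖ (n ⊕ o)  ≡⟨ shiftInvariant a n o ⟨
    a ⊖ n              ∎)

  ⊖-self-constant : ∀ n a → n ⊖ n ≡ a ⊖ a
  ⊖-self-constant n a = begin
    n ⊖ n              ≡⟨ shiftInvariant n n c ⟩
    (n ⊕ c) ⊖ (n ⊕ c)  ≡⟨ cong (λ z → z ⊖ z) (leftQuotient-spec plusQuasigroup n a) ⟩
    a ⊖ a              ∎
    where
    c : N
    c = leftQuotient plusQuasigroup n a

mainTheorem5 : ∀ {ℓ : Level} (N : Set ℓ) (_⊕_ : N → N → N) (_⊖_ : N → N → N) →
    N → IsDFBQ N _⊕_ _⊖_ →
    ∃! _≡_ (λ o → ∀ (a : N) → a ⊕ o ≡ a) × Σ N (λ e → ∀ (a : N) → e ≡ a ⊖ a)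
mainTheorem5 N _⊕_ _⊖_ n dfbq =
  (o , fixedPoint⇒rightIdentity dfbq (leftQuotient-spec plus n n)
     , λ isRightIdentity → leftQuotient-unique plus (isRightIdentity n))
  , (n ⊖ n , ⊖-self-constant dfbq n)
  where
  plus : IsQuasigroupOp N _⊕_
  plus = IsDFBQ.plusQuasigroup dfbq
  o : N
  o = leftQuotient plus n n
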